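{- Let $T$ be a binary tree with node set $V$ and let $K\ge1$ be an integer. For each $v\in V$ let $L_v$ and $R_v$ denote the number of nodes in the left subtree and in the right subtree of $v$, respectively (zero if the subtree is empty). Then $$\sum_{v\in V}\min(L_v,K)\cdot\min(R_v,K)=O(|V|\cdot K),$$ where the implied constant is absolute (independent of $T$ and $K$). -}

module Defs where

open import Data.Nat using (ℕ; zero; suc; _+_; _*_; _⊓_)

data Tree : Set where
  empty : Tree
  node  : Tree → Tree → Tree

size : Tree → ℕ
size empty      = 0
size (node l r) = suc (size l + size r)

cost : ℕ → Tree → ℕ
cost K empty      = 0
cost K (node l r) = (size l ⊓ K) * (size r ⊓ K) + cost K l + cost K r

{-# OPTIONS --safe #-}
module Submission where

-- Write n for the size of a tree and m = min(n, K). By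
-- induction on the tree, 2·cost + 4K·m ≤ 4K·n + m², i.e. cost ≤ 2K(n − m) + m²/2,
-- which is at most 2K·n + K·n/2. At a node with capped child sizes x, y and
-- capped size z, the term x·y added by the node is paid for by the drop of
-- 4K·m − m² from the children to the node: (x + y)² − 4K(x + y) ≤ z² − 4K·z + 4K,
-- since either z = x + y + 1, or z = K and K − 1 ≤ x + y ≤ 2K.

open import Defs
open import Data.Nat using (ℕ; suc; s≤s⁻¹; _+_; _*_; _⊓_; _≤_; _<?_; _≤?_)
open import Data.Nat.Properties
open import Data.Product using (∃-syntax; _,_)
open import Data.Sum using (inj₁; inj₂)
open import Data.List using ([]; _∷_)
open import Relation.Nullary using (yes; no)
open import Relation.Binary.PropositionalEquality using (refl; sym)
open import Data.Nat.Tactic.RingSolver using (solve)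

[m+n]⊓o≤m⊓o+n⊓o : ∀ m n o → (m + n) ⊓ o ≤ m ⊓ o + n ⊓ o
[m+n]⊓o≤m⊓o+n⊓o m n o with ≤-total o m | ≤-total o n
... | inj₁ o≤m | _ rewrite m≥n⇒m⊓n≡n o≤m = ≤-trans (m⊓n≤n (m + n) o) (m≤m+n o (n ⊓ o))
... | inj₂ m≤o | inj₁ o≤n rewrite m≥n⇒m⊓n≡n o≤n = ≤-trans (m⊓n≤n (m + n) o) (m≤n+m o (m ⊓ o))
... | inj₂ m≤o | inj₂ n≤o rewrite m≤n⇒m⊓n≡m m≤o | m≤n⇒m⊓n≡m n≤o = m⊓n≤m (m + n) o

square-growth : ∀ K t → t * t + 4 * K * suc t ≤ 4 * K + 4 * K * t + suc t * suc t
square-growth K t = begin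
  t * t + 4 * K * suc t        ≡⟨ solve (K ∷ t ∷ []) ⟩
  4 * K + 4 * K * t + t * t    ≤⟨ +-monoʳ-≤ (4 * K + 4 * K * t) (*-mono-≤ (n≤1+n t) (n≤1+n t)) ⟩
  4 * K + 4 * K * t + suc t * suc t ∎
  where open ≤-Reasoning

square-above : ∀ K d → d ≤ K → (K + d) * (K + d) + 4 * K * K ≤ 4 * K + 4 * K * (K + d) + K * K
square-above K d d≤K = begin
  (K + d) * (K + d) + 4 * K * K    ≡⟨ solve (K ∷ d ∷ []) ⟩
  5 * K * K + 2 * K * d + d * d    ≤⟨ +-monoʳ-≤ (5 * K * K + 2 * K * d) (*-monoˡ-≤ d d≤K) ⟩
  5 * K * K + 2 * K * d + K * d    ≤⟨ m≤m+n _ (4 * K + K * d) ⟩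
  5 * K * K + 2 * K * d + K * d + (4 * K + K * d) ≡⟨ solve (K ∷ d ∷ []) ⟩
  4 * K + 4 * K * (K + d) + K * K  ∎
  where open ≤-Reasoning

square-saturated : ∀ {K t} → K ≤ suc t → t ≤ K + K → t * t + 4 * K * K ≤ 4 * K + 4 * K * t + K * K
square-saturated {K} {t} K≤1+t t≤2K with t <? K
... | yes t<K rewrite ≤-antisym K≤1+t t<K = square-growth (suc t) t
... | no t≮K with m≤n⇒∃[o]m+o≡n (≮⇒≥ t≮K)
...   | d , refl = square-above K d (+-cancelˡ-≤ K d K t≤2K)

capped-merge : ∀ K a b →
  (a ⊓ K + b ⊓ K) * (a ⊓ K + b ⊓ K) + 4 * K * (suc (a + b) ⊓ K)
    ≤ 4 * K + 4 * K * (a ⊓ K + b ⊓ K) + (suc (a + b) ⊓ K) * (suc (a + b) ⊓ K)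
capped-merge K a b with suc (a + b) ≤? K
... | yes 1+a+b≤K
  rewrite m≤n⇒m⊓n≡m 1+a+b≤K
        | m≤n⇒m⊓n≡m (≤-trans (m≤m+n a b) (<⇒≤ 1+a+b≤K))
        | m≤n⇒m⊓n≡m (≤-trans (m≤n+m b a) (<⇒≤ 1+a+b≤K))
  = square-growth K (a + b)
... | no 1+a+b≰K rewrite m≥n⇒m⊓n≡n (<⇒≤ (≰⇒> 1+a+b≰K)) =
  square-saturated (m≤n⇒m≤1+n K≤x+y) (+-mono-≤ (m⊓n≤n a K) (m⊓n≤n b K))
  where
  K≤x+y : K ≤ a ⊓ K + b ⊓ K
  K≤x+y = ≤-trans (≤-reflexive (sym (m≥n⇒m⊓n≡n (s≤s⁻¹ (≰⇒> 1+a+b≰K))))) ([m+n]⊓o≤m⊓o+n⊓o a b K)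

record Bounded (K n m c : ℕ) : Set where
  constructor bounded
  field bound : 2 * c + 4 * K * m ≤ 4 * K * n + m * m

bounded-node : ∀ {K a b x y z c₁ c₂} →
  Bounded K a x c₁ → Bounded K b y c₂ →
  (x + y) * (x + y) + 4 * K * z ≤ 4 * K + 4 * K * (x + y) + z * z →
  Bounded K (suc (a + b)) z (x * y + c₁ + c₂)
bounded-node {K} {a} {b} {x} {y} {z} {c₁} {c₂} (bounded left) (bounded right) merge =
  bounded (+-cancelʳ-≤ (4 * K * (x + y)) _ _ (begin
    2 * (x * y + c₁ + c₂) + 4 * K * z + 4 * K * (x + y)
      ≡⟨ solve (K ∷ x ∷ y ∷ z ∷ c₁ ∷ c₂ ∷ []) ⟩
    2 * x * y + (2 * c₁ + 4 * K * x) + (2 * c₂ + 4 * K * y) + 4 * K * z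
      ≤⟨ +-monoˡ-≤ (4 * K * z) (+-mono-≤ (+-monoʳ-≤ (2 * x * y) left) right) ⟩
    2 * x * y + (4 * K * a + x * x) + (4 * K * b + y * y) + 4 * K * z
      ≡⟨ solve (K ∷ a ∷ b ∷ x ∷ y ∷ z ∷ []) ⟩
    4 * K * (a + b) + ((x + y) * (x + y) + 4 * K * z)
      ≤⟨ +-monoʳ-≤ (4 * K * (a + b)) merge ⟩
    4 * K * (a + b) + (4 * K + 4 * K * (x + y) + z * z)
      ≡⟨ solve (K ∷ a ∷ b ∷ x ∷ y ∷ z ∷ []) ⟩
    4 * K * suc (a + b) + z * z + 4 * K * (x + y) ∎))
  where open ≤-Reasoning

cost-bounded : ∀ K T → Bounded K (size T) (size T ⊓ K) (cost K T)
cost-bounded K empty      = bounded (m≤m+n (4 * K * 0) 0)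
cost-bounded K (node l r) =
  bounded-node (cost-bounded K l) (cost-bounded K r) (capped-merge K (size l) (size r))

bounded⇒≤5nK : ∀ {K n c} → Bounded K n (n ⊓ K) c → c ≤ 5 * (n * K)
bounded⇒≤5nK {K} {n} {c} (bounded bound) = begin
  c                         ≤⟨ m≤n*m c 2 ⟩
  2 * c                     ≤⟨ m≤m+n (2 * c) (4 * K * m) ⟩
  2 * c + 4 * K * m         ≤⟨ bound ⟩
  4 * K * n + m * m         ≤⟨ +-monoʳ-≤ (4 * K * n) (*-mono-≤ (m⊓n≤n n K) (m⊓n≤m n K)) ⟩
  4 * K * n + K * n         ≡⟨ solve (K ∷ n ∷ []) ⟩
  5 * (n * K)               ∎
  where
  m : ℕ
  m = n ⊓ K
  open ≤-Reasoning

lemma6 : ∃[ C ] ((T : Tree) (K : ℕ) → 1 ≤ K → cost K T ≤ C * (size T * K))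
lemma6 = 5 , λ T K _ → bounded⇒≤5nK (cost-bounded K T)
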